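{- Let $\delta\ge 1$ be an integer and let $(V,E)$ be a finite simple graph such that $\deg(v_1)+\deg(v_2)\ge\delta$ for every edge $(v_1,v_2)\in E$. If $(V,E)$ has no isolated vertices, then $|E|\ge(1-\delta^{ -1})|V|$. -}

module Defs where

open import Data.Nat using (ℕ; _+_; _*_; _∸_; _≤_; _<_)
open import Data.Fin using (Fin; toℕ)
open import Data.Bool using (Bool; true; false; if_then_else_)
open import Data.List using (List; map; allFin)
open import Data.Nat.ListAction using (sum)
open import Data.Product using (_×_)
open import Relation.Binary.PropositionalEquality using (_≡_)
open import Relation.Nullary using (¬_)

record SimpleGraph (n : ℕ) : Set where
  field
    adj      : Fin n → Fin n → Bool
    irrefl   : ∀ i → adj i i ≡ false
    symmetric : ∀ i j → adj i j ≡ adj j i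
open SimpleGraph public

ind : Bool → ℕ
ind true  = 1
ind false = 0

count : ∀ {n} → (Fin n → Bool) → ℕ
count {n} p = sum (map (λ i → ind (p i)) (allFin n))

deg : ∀ {n} → SimpleGraph n → Fin n → ℕ
deg G v = count (adj G v)

-- number of edges: unordered pairs {i,j} (counted once via toℕ i < toℕ j)
ltb : ∀ {n} → Fin n → Fin n → Bool
ltb i j = toℕ i Data.Nat.<ᵇ toℕ j

numEdges : ∀ {n} → SimpleGraph n → ℕ
numEdges {n} G =
  sum (map (λ i → count (λ j → if ltb i j then adj G i j else false)) (allFin n))

NoIsolated : ∀ {n} → SimpleGraph n → Set
NoIsolated G = ∀ v → 1 ≤ deg G v

module Submission where

-- Proof by discharging (double counting with weights), scaled by 2δ to
-- stay in ℕ.  Every ordered pair (i, j) of adjacent vertices carries a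
-- weight  share δ (deg i) (deg j) : the part of the edge {i, j} that i
-- receives.  Two facts about these shares do all the work:
--   * edge bound:   an edge hands out at most 2δ in total to its ends;
--   * vertex bound: a non-isolated vertex receives at least 2(δ - 1).
-- A general discharging lemma (valid for any weights on any graph) turns
-- these into  2(δ - 1)·|V| ≤ 2δ·|E| , and cancelling 2 gives the theorem.

open import Defs
open import Data.Nat using (ℕ; _+_; _*_; _∸_; _≤_)
open import Data.Fin using (Fin)
open import Data.Bool using (true)
open import Relation.Binary.PropositionalEquality using (_≡_)

open import Data.Nat using (zero; suc; z≤n; s≤s; _<_; _<ᵇ_; _≤?_)
open import Data.Nat.Properties
open import Data.Fin using (toℕ) renaming (zero to fzero; suc to fsuc)
open import Data.Fin.Properties using (toℕ-injective)
open import Data.Bool using (Bool; false; if_then_else_)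
open import Data.List using (tabulate; map; allFin)
import Data.Nat.ListAction as List
open import Function using (_∘_)
open import Relation.Binary.Definitions using (tri<; tri≈; tri>)
open import Relation.Binary.PropositionalEquality
  using (refl; sym; trans; cong; subst; module ≡-Reasoning)
open import Relation.Nullary using (yes; no; ¬_; contradiction)
open import Relation.Nullary.Reflects using (ofʸ; ofⁿ)
open import Data.List.Properties using (map-tabulate)

open import Algebra.Properties.Semiring.Sum +-*-semiring
  using (sum; sum-syntax; sum-cong-≗; ∑-distrib-+; ∑-comm; *-distribʳ-sum)

∑-mono-≤ : ∀ {n} {f g : Fin n → ℕ} → (∀ i → f i ≤ g i) → sum f ≤ sum g
∑-mono-≤ {zero}  f≤g = z≤n
∑-mono-≤ {suc n} f≤g = +-mono-≤ (f≤g fzero) (∑-mono-≤ (f≤g ∘ fsuc))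

∑-const : ∀ {n} (c : ℕ) → ∑[ i < n ] c ≡ c * n
∑-const {zero}  c = sym (*-zeroʳ c)
∑-const {suc n} c = trans (cong (c +_) (∑-const c)) (sym (*-suc c n))

∑∑-distrib-+ : ∀ {n} (f g : Fin n → Fin n → ℕ) →
  ∑[ i < n ] ∑[ j < n ] (f i j + g i j)
    ≡ ∑[ i < n ] ∑[ j < n ] f i j + ∑[ i < n ] ∑[ j < n ] g i j
∑∑-distrib-+ {n} f g =
  trans (sum-cong-≗ (λ i → ∑-distrib-+ (f i) (g i)))
        (∑-distrib-+ (λ i → sum (f i)) (λ i → sum (g i)))

∑∑-transpose : ∀ {n} (f g : Fin n → Fin n → ℕ) →
  ∑[ i < n ] ∑[ j < n ] (f i j + g j i) ≡ ∑[ i < n ] ∑[ j < n ] (f i j + g i j)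
∑∑-transpose {n} f g = begin
  ∑[ i < n ] ∑[ j < n ] (f i j + g j i)                        ≡⟨ ∑∑-distrib-+ f (λ i j → g j i) ⟩
  ∑[ i < n ] ∑[ j < n ] f i j + ∑[ i < n ] ∑[ j < n ] g j i    ≡⟨ cong (_ +_) (∑-comm (λ i j → g j i)) ⟩
  ∑[ i < n ] ∑[ j < n ] f i j + ∑[ j < n ] ∑[ i < n ] g j i    ≡⟨ sym (∑∑-distrib-+ f g) ⟩
  ∑[ i < n ] ∑[ j < n ] (f i j + g i j)                        ∎
  where open ≡-Reasoning

listSum-allFin : ∀ {n} (f : Fin n → ℕ) → List.sum (map f (allFin n)) ≡ sum f
listSum-allFin f = trans (cong List.sum (map-tabulate (λ i → i) f)) (listSum-tabulate f)
  where
  listSum-tabulate : ∀ {n} (h : Fin n → ℕ) → List.sum (tabulate h) ≡ sum h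
  listSum-tabulate {zero}  h = refl
  listSum-tabulate {suc n} h = cong (h fzero +_) (listSum-tabulate (h ∘ fsuc))

count-∑ : ∀ {n} (p : Fin n → Bool) → count p ≡ ∑[ j < n ] ind (p j)
count-∑ p = listSum-allFin (λ j → ind (p j))

ind-*-mono : ∀ (x : Bool) {m k : ℕ} → (x ≡ true → m ≤ k) → ind x * m ≤ ind x * k
ind-*-mono true  m≤k = +-mono-≤ (m≤k refl) z≤n
ind-*-mono false m≤k = z≤n

weightedCount-≥ : ∀ {n} (p : Fin n → Bool) (w : Fin n → ℕ) {d m : ℕ} →
  count p ≡ d → (∀ j → p j ≡ true → m ≤ w j) →
  d * m ≤ ∑[ j < n ] (ind (p j) * w j)
weightedCount-≥ {n} p w {d} {m} count≡d m≤w = begin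
  d * m                         ≡⟨ cong (_* m) (trans (sym count≡d) (count-∑ p)) ⟩
  (∑[ j < n ] ind (p j)) * m    ≡⟨ *-distribʳ-sum m (ind ∘ p) ⟩
  ∑[ j < n ] (ind (p j) * m)    ≤⟨ ∑-mono-≤ (λ j → ind-*-mono (p j) (m≤w j)) ⟩
  ∑[ j < n ] (ind (p j) * w j)  ∎
  where open ≤-Reasoning

<ᵇ-true : ∀ {m k} → m < k → (m <ᵇ k) ≡ true
<ᵇ-true {m} {k} m<k with m <ᵇ k | <ᵇ-reflects-< m k
... | true  | _       = refl
... | false | ofⁿ m≮k = contradiction m<k m≮k

<ᵇ-false : ∀ {m k} → ¬ m < k → (m <ᵇ k) ≡ false
<ᵇ-false {m} {k} m≮k with m <ᵇ k | <ᵇ-reflects-< m k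
... | true  | ofʸ m<k = contradiction m<k m≮k
... | false | _       = refl

above : ∀ {n} → SimpleGraph n → Fin n → Fin n → Bool
above G i j = if ltb i j then adj G i j else false

above⇒adj : ∀ {n} (G : SimpleGraph n) i j → above G i j ≡ true → adj G i j ≡ true
above⇒adj G i j with ltb i j
... | true  = λ i~j → i~j
... | false = λ ()

above-orientations : ∀ {n} (G : SimpleGraph n) (i j : Fin n) →
  ind (above G i j) + ind (above G j i) ≡ ind (adj G i j)
above-orientations G i j with <-cmp (toℕ i) (toℕ j)
... | tri< i<j _ j≮i rewrite <ᵇ-true i<j | <ᵇ-false j≮i = +-identityʳ _
... | tri> i≮j _ j<i rewrite <ᵇ-false i≮j | <ᵇ-true j<i =
  cong ind (symmetric G j i)
... | tri≈ i≮j i≡j _ with toℕ-injective i≡j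
...   | refl rewrite <ᵇ-false i≮j | irrefl G i = refl

numEdges-∑ : ∀ {n} (G : SimpleGraph n) →
  numEdges G ≡ ∑[ i < n ] ∑[ j < n ] ind (above G i j)
numEdges-∑ {n} G = trans (listSum-allFin (λ i → count (above G i)))
                          (sum-cong-≗ (λ i → count-∑ (above G i)))

handshake : ∀ {n} (G : SimpleGraph n) (w : Fin n → Fin n → ℕ) →
  ∑[ i < n ] ∑[ j < n ] (ind (adj G i j) * w i j)
    ≡ ∑[ i < n ] ∑[ j < n ] (ind (above G i j) * (w i j + w j i))
handshake {n} G w = begin
  ∑[ i < n ] ∑[ j < n ] (ind (adj G i j) * w i j)
    ≡⟨ sum-cong-≗ (λ i → sum-cong-≗ (λ j → split i j)) ⟩
  ∑[ i < n ] ∑[ j < n ] (e i j * w i j + e j i * w i j)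
    ≡⟨ ∑∑-transpose (λ i j → e i j * w i j) (λ i j → e i j * w j i) ⟩
  ∑[ i < n ] ∑[ j < n ] (e i j * w i j + e i j * w j i)
    ≡⟨ sum-cong-≗ (λ i → sum-cong-≗ (λ j → sym (*-distribˡ-+ (e i j) _ _))) ⟩
  ∑[ i < n ] ∑[ j < n ] (e i j * (w i j + w j i))
    ∎
  where
  open ≡-Reasoning
  e : Fin n → Fin n → ℕ
  e i j = ind (above G i j)
  split : ∀ i j → ind (adj G i j) * w i j ≡ e i j * w i j + e j i * w i j
  split i j = trans (cong (_* w i j) (sym (above-orientations G i j)))
                    (*-distribʳ-+ (w i j) (e i j) (e j i))

discharge : ∀ {n} (G : SimpleGraph n) (w : Fin n → Fin n → ℕ) (r c : ℕ) →
  (∀ i → r ≤ ∑[ j < n ] (ind (adj G i j) * w i j)) →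
  (∀ i j → adj G i j ≡ true → w i j + w j i ≤ c) →
  r * n ≤ c * numEdges G
discharge {n} G w r c vertex edge = begin
  r * n                                            ≡⟨ sym (∑-const r) ⟩
  ∑[ i < n ] r                                     ≤⟨ ∑-mono-≤ vertex ⟩
  ∑[ i < n ] ∑[ j < n ] (ind (adj G i j) * w i j)  ≡⟨ handshake G w ⟩
  ∑[ i < n ] ∑[ j < n ] (e i j * (w i j + w j i))  ≤⟨ ∑-mono-≤ (λ i → ∑-mono-≤ (λ j → perEdge i j)) ⟩
  ∑[ i < n ] ∑[ j < n ] (e i j * c)                ≡⟨ sym pullOut ⟩
  (∑[ i < n ] ∑[ j < n ] e i j) * c                ≡⟨ cong (_* c) (sym (numEdges-∑ G)) ⟩
  numEdges G * c                                   ≡⟨ *-comm (numEdges G) c ⟩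
  c * numEdges G                                   ∎
  where
  open ≤-Reasoning
  e : Fin n → Fin n → ℕ
  e i j = ind (above G i j)
  perEdge : ∀ i j → e i j * (w i j + w j i) ≤ e i j * c
  perEdge i j = ind-*-mono (above G i j) (edge i j ∘ above⇒adj G i j)
  pullOut : (∑[ i < n ] ∑[ j < n ] e i j) * c ≡ ∑[ i < n ] ∑[ j < n ] (e i j * c)
  pullOut = trans (*-distribʳ-sum c (λ i → sum (e i)))
                  (sum-cong-≗ (λ i → *-distribʳ-sum c (e i)))

-- share δ a b : what an endpoint of degree a gets from an edge whose other
-- endpoint has degree b.
share : ℕ → ℕ → ℕ → ℕ
share δ 1 b = 2 * (δ ∸ 1)
share δ a 1 = 2
share δ a b = δ

-- Edge bound: the two shares of an edge {i, j} with deg i + deg j ≥ δ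
-- sum to at most 2δ.  An edge between two leaves forces δ ≤ 2; in every
-- other case the shares add up to exactly 2δ.
edgeBound : ∀ δ {a b} → 1 ≤ δ → 1 ≤ a → 1 ≤ b → δ ≤ a + b →
  share δ a b + share δ b a ≤ 2 * δ
edgeBound 1                   {1}           {1}           _ _ _ _ = z≤n
edgeBound 2                   {1}           {1}           _ _ _ _ = ≤-refl
edgeBound (suc (suc (suc k))) {1}           {1}           _ _ _ (s≤s (s≤s ()))
edgeBound (suc k)             {1}           {suc (suc b)} _ _ _ _ =
  ≤-reflexive (trans (+-comm (2 * k) 2) (sym (*-suc 2 k)))
edgeBound (suc k)             {suc (suc a)} {1}           _ _ _ _ =
  ≤-reflexive (sym (*-suc 2 k))
edgeBound δ                   {suc (suc a)} {suc (suc b)} _ _ _ _ =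
  ≤-reflexive (cong (δ +_) (sym (+-identityʳ δ)))

share-nonLeaf : ∀ k a b → 2 ≤ share (suc (suc k)) (suc (suc a)) b
share-nonLeaf k a zero          = s≤s (s≤s z≤n)
share-nonLeaf k a (suc zero)    = ≤-refl
share-nonLeaf k a (suc (suc b)) = s≤s (s≤s z≤n)

share-inner : ∀ δ a {b} → 2 ≤ b → δ ≤ share δ (suc (suc a)) b
share-inner δ a (s≤s (s≤s _)) = ≤-refl

neighbour-nonLeaf : ∀ {δ d b} → 2 + d ≤ δ → δ ≤ d + b → 2 ≤ b
neighbour-nonLeaf {δ} {d} {b} 2+d≤δ δ≤d+b =
  +-cancelˡ-≤ d 2 b (subst (_≤ d + b) (+-comm 2 d) (≤-trans 2+d≤δ δ≤d+b))

-- For δ ≤ 1 there is nothing to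
-- show; a leaf receives exactly 2(δ - 1); a vertex of degree D ≥ 2 gets
-- δ from each of its D non-leaf neighbours if D ≤ δ - 2, and otherwise
-- at least 2 from each neighbour, with 2D ≥ 2(δ - 1).
vertexBound : ∀ δ {n} (p : Fin n → Bool) (b : Fin n → ℕ) {d} →
  count p ≡ d → 1 ≤ d → (∀ j → p j ≡ true → δ ≤ d + b j) →
  2 * (δ ∸ 1) ≤ ∑[ j < n ] (ind (p j) * share δ d (b j))
vertexBound zero                 p b _     _ _ = z≤n
vertexBound (suc zero)           p b _     _ _ = z≤n
vertexBound δ@(suc (suc k)) {n}  p b {1}   deg≡1 _ _ =
  subst (_≤ ∑[ j < n ] (ind (p j) * share δ 1 (b j))) (*-identityˡ (2 * (δ ∸ 1)))
    (weightedCount-≥ p (λ j → share δ 1 (b j)) deg≡1 (λ _ _ → ≤-refl))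
vertexBound δ@(suc (suc k)) {n}  p b {suc (suc d)} deg≡d _ cond
  with 2 + suc (suc d) ≤? δ
... | yes lowDegree = begin
  2 * suc k             ≤⟨ *-mono-≤ (s≤s (s≤s (z≤n {d}))) (n≤1+n (suc k)) ⟩
  suc (suc d) * δ       ≤⟨ weightedCount-≥ p _ deg≡d
                             (λ j j~ → share-inner δ d (neighbour-nonLeaf lowDegree (cond j j~))) ⟩
  ∑[ j < n ] (ind (p j) * share δ (suc (suc d)) (b j)) ∎
  where open ≤-Reasoning
... | no highDegree = begin
  2 * suc k             ≤⟨ *-monoʳ-≤ 2 (≤-pred (≤-pred (≰⇒> highDegree))) ⟩
  2 * suc (suc d)       ≡⟨ *-comm 2 (suc (suc d)) ⟩
  suc (suc d) * 2       ≤⟨ weightedCount-≥ p _ deg≡d (λ j _ → share-nonLeaf k d (b j)) ⟩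
  ∑[ j < n ] (ind (p j) * share δ (suc (suc d)) (b j)) ∎
  where open ≤-Reasoning

lemma4p8 : (δ : ℕ) → 1 ≤ δ → (n : ℕ) → (G : SimpleGraph n) →
    (∀ (v₁ v₂ : Fin n) → adj G v₁ v₂ ≡ true → δ ≤ deg G v₁ + deg G v₂) →
    NoIsolated G →
    (δ ∸ 1) * n ≤ δ * numEdges G
lemma4p8 δ 1≤δ n G degSum noIsolated = *-cancelˡ-≤ 2 (begin
  2 * ((δ ∸ 1) * n)        ≡⟨ sym (*-assoc 2 (δ ∸ 1) n) ⟩
  2 * (δ ∸ 1) * n          ≤⟨ discharge G w (2 * (δ ∸ 1)) (2 * δ) received handedOut ⟩
  2 * δ * numEdges G       ≡⟨ *-assoc 2 δ (numEdges G) ⟩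
  2 * (δ * numEdges G)     ∎)
  where
  open ≤-Reasoning
  w : Fin n → Fin n → ℕ
  w i j = share δ (deg G i) (deg G j)
  received : ∀ i → 2 * (δ ∸ 1) ≤ ∑[ j < n ] (ind (adj G i j) * w i j)
  received i = vertexBound δ (adj G i) (deg G) refl (noIsolated i) (degSum i)
  handedOut : ∀ i j → adj G i j ≡ true → w i j + w j i ≤ 2 * δ
  handedOut i j i~j = edgeBound δ 1≤δ (noIsolated i) (noIsolated j) (degSum i j i~j)
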